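{- Let $\sigma,\omega\in S_\infty$ with $\sigma<_{\mathrm{Bruhat}}\omega$. Then the poset $([\sigma,\omega]^f,<_{\mathrm{Bruhat}})$ is $\mathbb N$-graded, and its rank function is the relative length function $\ell_\sigma$.
   Context: $S_\infty$ is the group of bijections $\mathbb N\to\mathbb N$. Bruhat order: $\sigma\le_{\mathrm{Bruhat}}\omega$ iff for every $n$, the $i$-th smallest element of $\{\sigma(1),\dots,\sigma(n)\}$ is at most the $i$-th smallest of $\{\omega(1),\dots,\omega(n)\}$ for all $i$. $\sigma\approx\nu$ means $\sigma(n)\ne\nu(n)$ for only finitely many $n$. $[\sigma,\omega]^f=\{\nu:\sigma\le_{\mathrm{Bruhat}}\nu\le_{\mathrm{Bruhat}}\omega,\ \nu\approx\sigma\}$. For $\tau\in S_\infty$, $D_i(\tau)=\{j>i:\tau(i)>\tau(j)\}$ and $\ell_i(\tau)=\sum_{n\le i}|D_n(\tau)|$. For $\nu\approx\sigma$ with $\sigma\le_{\mathrm{Bruhat}}\nu$, the difference $\ell_i(\nu)-\ell_i(\sigma)$ is eventually constant, and the relative length is $\ell_\sigma(\nu)=\lim_{i\to\infty}(\ell_i(\nu)-\ell_i(\sigma))$. A poset $P$ is $\mathbb N$-graded if (G1) it has a unique minimal element $\hat0$, (G2) for every $p$ there is a finite saturated chain from $\hat0$ to $p$ (saturated: contains every element strictly between two of its elements), and (G3) for every $p$ all maximal chains in $[\hat0,p]$ have the same length; this common length is the rank $\rho(p)$, and $\rho$ is the rank function. -}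

module Defs where

open import Data.Nat using (ℕ; zero; suc; _≤_; _<?_)
open import Data.Nat.Properties using (≤-decTotalOrder)
open import Data.Integer using (ℤ; _⊖_; +_)
open import Data.List using (List; map; upTo; filter; length; foldr)
open import Data.Nat.ListAction using (sum)
open import Data.List.Relation.Binary.Pointwise using (Pointwise)
open import Data.Product using (Σ; ∃; _×_; _,_; proj₁)
open import Data.Empty using (⊥)
open import Relation.Nullary using (¬_)
open import Relation.Binary.PropositionalEquality using (_≡_)
import Data.Nat as N
open import Data.List.Sort.InsertionSort.Base ≤-decTotalOrder using (sort)

-- S_∞ : bijections ℕ → ℕ (ℕ here starts at 0; the paper's ℕ starts at 1,
-- which is an order-isomorphic index shift).

record Perm : Set where
  field
    fun   : ℕ → ℕ
    inv   : ℕ → ℕ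
    inv∘fun : ∀ n → inv (fun n) ≡ n
    fun∘inv : ∀ n → fun (inv n) ≡ n
open Perm public

_≐_ : Perm → Perm → Set
σ ≐ ω = ∀ n → fun σ n ≡ fun ω n

sortedPrefix : Perm → ℕ → List ℕ
sortedPrefix τ n = sort (map (fun τ) (upTo n))

_≤B_ : Perm → Perm → Set
σ ≤B ω = ∀ n → Pointwise _≤_ (sortedPrefix σ n) (sortedPrefix ω n)

_<B_ : Perm → Perm → Set
σ <B ω = σ ≤B ω × ¬ (σ ≐ ω)

_≈f_ : Perm → Perm → Set
σ ≈f ν = ∃ λ N → ∀ n → N ≤ n → fun σ n ≡ fun ν n

-- D_i(τ) = { j > i : τ(i) > τ(j) }.  Every such j satisfies
-- j = τ⁻¹(τ j) with τ j < τ i, so j < bound τ i below; hence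
-- |D_i(τ)| is the number of j in the finite range (i, bound τ i)
-- with τ j < τ i.

maxList : List ℕ → ℕ
maxList = foldr N._⊔_ 0

bound : Perm → ℕ → ℕ
bound τ i = suc (maxList (map (inv τ) (upTo (fun τ i))))

Dcard : Perm → ℕ → ℕ
Dcard τ i =
  length (filter (λ j → fun τ j <? fun τ i)
                 (filter (λ j → i <? j) (upTo (bound τ i))))

ℓ : ℕ → Perm → ℕ
ℓ i τ = sum (map (Dcard τ) (upTo (suc i)))

IsRelLength : Perm → Perm → ℕ → Set
IsRelLength σ ν k = ∃ λ N → ∀ i → N ≤ i → ℓ i ν ⊖ ℓ i σ ≡ + k

Interval : Perm → Perm → Set
Interval σ ω = Σ Perm λ ν → σ ≤B ν × ν ≤B ω × ν ≈f σ

module Graded {P : Set} (_≈_ : P → P → Set) (_≤_ : P → P → Set) where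

  _<ₚ_ : P → P → Set
  x <ₚ y = x ≤ y × ¬ (x ≈ y)

  Minimal : P → Set
  Minimal p = ∀ q → q <ₚ p → ⊥

  _⋖_ : P → P → Set
  x ⋖ y = x <ₚ y × (∀ z → x <ₚ z → z <ₚ y → ⊥)

  data SatChain : P → P → ℕ → Set where
    done : ∀ {a b} → a ≈ b → SatChain a b 0
    step : ∀ {a c b n} → a ⋖ c → SatChain c b n → SatChain a b (suc n)

  IsGradedWithRank : (P → ℕ) → Set
  IsGradedWithRank ρ =
    Σ P λ 0̂ →
      (Minimal 0̂ × (∀ p → Minimal p → p ≈ 0̂))
      × (∀ p → ∃ λ n → SatChain 0̂ p n)
      × (∀ p n → SatChain 0̂ p n → n ≡ ρ p)

module IntervalPoset (σ ω : Perm) =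
  Graded {Interval σ ω} (λ x y → proj₁ x ≐ proj₁ y) (λ x y → proj₁ x ≤B proj₁ y)

{-# OPTIONS --safe #-}
module Submission where

-- Write above f n k for the number of positions a < n with k ≤ f a. Comparing sorted
-- prefixes entrywise is the same as comparing these counts, so σ ≤ ω in Bruhat order iff
-- above σ n k ≤ above ω n k for all n and k.
--
-- If x < y agree from M on, let i be the first position where they differ (then x i < y i)
-- and j the first position after i with x i < x j ≤ y i. Exchanging the values of x at i and j
-- gives x′ with x < x′ ≤ y; as no position between i and j carries a value in (x i, x j),
-- x′ has exactly one inversion more than x, so ℓ_m x′ = ℓ_m x + 1 for m ≥ j. A bounded
-- potential increases along such exchanges, so finitely many of them lead from x to y.
-- Their chains are saturated, and every cover x ⋖ z is a single exchange, so ℓ grows by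
-- exactly one along every cover; hence every saturated chain from σ to p has length ℓ_σ(p).

open import Defs
open import Data.Product using (Σ; _×_; proj₁)
open import Data.Nat using (ℕ)

open import Data.Bool using (if_then_else_)
open import Data.Empty using (⊥; ⊥-elim)
import Data.Integer as ℤ
open import Data.Integer.Properties using (≤-⊖)
open import Data.List using (List; []; _∷_; _∷ʳ_; map; upTo; filter; length)
open import Data.List.Membership.Propositional using (_∈_)
open import Data.List.Membership.Propositional.Properties using (∈-map⁺; ∈-upTo⁺)
open import Data.List.Properties
  using (map-++; map-∘; length-map; length-upTo; upTo-∷ʳ; filter-all; filter-reject; length-filter)
open import Data.List.Relation.Binary.Permutation.Propositional.Properties using (↭-length; filter-↭)
open import Data.List.Relation.Binary.Pointwise as Pointwise using (Pointwise; []; _∷_)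
open import Data.List.Relation.Unary.All as All using (All)
open import Data.List.Relation.Unary.Any using (here; there)
open import Data.List.Relation.Unary.Linked as Linked using (Linked)
open import Data.List.Relation.Unary.Linked.Properties using (Linked⇒All)
open import Data.Nat using (zero; suc; _+_; _∸_; _⊔_; _≤_; _<_; _≤?_; _<?_; _≟_; z≤n; s≤s)
open import Data.Nat.Induction using (<-wellFounded)
open import Data.Nat.ListAction using (sum)
open import Data.Nat.ListAction.Properties using (sum-++)
open import Data.Nat.Properties
open import Data.Product as Product using (∃; _,_; proj₂)
open import Data.Sum as Sum using (_⊎_; inj₁; inj₂; [_,_]′)
open import Function using (_∘_; id; const)
open import Induction.WellFounded using (Acc; acc)
open import Relation.Binary.Definitions using (Tri; tri<; tri≈; tri>)
open import Relation.Binary.PropositionalEquality hiding (J)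
open import Relation.Nullary using (Dec; yes; no; does; ¬_; contradiction)
open import Relation.Nullary.Decidable using (dec-true; dec-false; _×-dec_; ¬?; decidable-stable)
open import Relation.Unary using (Decidable)

open import Algebra.Properties.CommutativeSemigroup +-commutativeSemigroup using (x∙yz≈y∙xz; xy∙z≈xz∙y)
open import Data.List.Sort.InsertionSort.Properties ≤-decTotalOrder using (sort-↭; sort-↗)

-- Indicators and finite sums

𝟙 : {A : Set} → Dec A → ℕ
𝟙 a? = if does a? then 1 else 0

𝟙-yes : {A : Set} (a? : Dec A) → A → 𝟙 a? ≡ 1
𝟙-yes a? a rewrite dec-true a? a = refl

𝟙-no : {A : Set} (a? : Dec A) → ¬ A → 𝟙 a? ≡ 0
𝟙-no a? ¬a rewrite dec-false a? ¬a = refl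

𝟙-mono : {A B : Set} (a? : Dec A) (b? : Dec B) → (A → B) → 𝟙 a? ≤ 𝟙 b?
𝟙-mono (yes a) b? a→b = ≤-reflexive (sym (𝟙-yes b? (a→b a)))
𝟙-mono (no _)  b? a→b = z≤n

𝟙-cong : {A B : Set} (a? : Dec A) (b? : Dec B) → (A → B) → (B → A) → 𝟙 a? ≡ 𝟙 b?
𝟙-cong a? b? a→b b→a = ≤-antisym (𝟙-mono a? b? a→b) (𝟙-mono b? a? b→a)

𝟙-×-yes : {A B : Set} (a? : Dec A) (b? : Dec B) → A → 𝟙 (a? ×-dec b?) ≡ 𝟙 b?
𝟙-×-yes a? b? a rewrite dec-true a? a = refl

𝟙-×-no : {A B : Set} (a? : Dec A) (b? : Dec B) → ¬ A → 𝟙 (a? ×-dec b?) ≡ 0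
𝟙-×-no a? b? ¬a rewrite dec-false a? ¬a = refl

∑< : ℕ → (ℕ → ℕ) → ℕ
∑< zero    f = 0
∑< (suc n) f = ∑< n f + f n

syntax ∑< n (λ a → e) = ∑[ a < n ] e

module _ {f g : ℕ → ℕ} where

  ∑-cong : ∀ n → (∀ a → a < n → f a ≡ g a) → ∑< n f ≡ ∑< n g
  ∑-cong zero    f≡g = refl
  ∑-cong (suc n) f≡g = cong₂ _+_ (∑-cong n (λ a → f≡g a ∘ m<n⇒m<1+n)) (f≡g n ≤-refl)

  ∑-mono-≤ : ∀ n → (∀ a → a < n → f a ≤ g a) → ∑< n f ≤ ∑< n g
  ∑-mono-≤ zero    f≤g = z≤n
  ∑-mono-≤ (suc n) f≤g = +-mono-≤ (∑-mono-≤ n (λ a → f≤g a ∘ m<n⇒m<1+n)) (f≤g n ≤-refl)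

  ∑-mono-< : ∀ n {p} → (∀ a → a < n → f a ≤ g a) → p < n → f p < g p → ∑< n f < ∑< n g
  ∑-mono-< (suc n) f≤g p<1+n fp<gp with m<1+n⇒m<n∨m≡n p<1+n
  ... | inj₁ p<n  = +-mono-<-≤ (∑-mono-< n (λ a → f≤g a ∘ m<n⇒m<1+n) p<n fp<gp) (f≤g n ≤-refl)
  ... | inj₂ refl = +-mono-≤-< (∑-mono-≤ n (λ a → f≤g a ∘ m<n⇒m<1+n)) fp<gp

  ∑-distrib-+ : ∀ n → ∑[ a < n ] (f a + g a) ≡ ∑< n f + ∑< n g
  ∑-distrib-+ zero    = refl
  ∑-distrib-+ (suc n) = begin
    ∑[ a < n ] (f a + g a) + (f n + g n)   ≡⟨ cong (_+ (f n + g n)) (∑-distrib-+ n) ⟩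
    ∑< n f + ∑< n g + (f n + g n)          ≡⟨ +-assoc (∑< n f) _ _ ⟩
    ∑< n f + (∑< n g + (f n + g n))        ≡⟨ cong (∑< n f +_) (x∙yz≈y∙xz (∑< n g) (f n) (g n)) ⟩
    ∑< n f + (f n + (∑< n g + g n))        ≡⟨ +-assoc (∑< n f) _ _ ⟨
    ∑< n f + f n + (∑< n g + g n)          ∎
    where open ≡-Reasoning

  ∑-update : ∀ n {i} → i < n → (∀ a → a < n → a ≢ i → f a ≡ g a) → ∑< n f + g i ≡ ∑< n g + f i
  ∑-update (suc n) {i} i<1+n f≡g with m<1+n⇒m<n∨m≡n i<1+n
  ... | inj₂ refl = begin
    ∑< n f + f i + g i  ≡⟨ cong (λ s → s + f i + g i)
                             (∑-cong n (λ a a<n → f≡g a (m<n⇒m<1+n a<n) (<⇒≢ a<n))) ⟩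
    ∑< n g + f i + g i  ≡⟨ xy∙z≈xz∙y (∑< n g) (f i) (g i) ⟩
    ∑< n g + g i + f i  ∎
    where open ≡-Reasoning
  ... | inj₁ i<n = begin
    ∑< n f + f n + g i  ≡⟨ xy∙z≈xz∙y (∑< n f) (f n) (g i) ⟩
    ∑< n f + g i + f n  ≡⟨ cong (_+ f n) (∑-update n i<n (λ a a<n → f≡g a (m<n⇒m<1+n a<n))) ⟩
    ∑< n g + f i + f n  ≡⟨ xy∙z≈xz∙y (∑< n g) (f i) (f n) ⟩
    ∑< n g + f n + f i  ≡⟨ cong (λ v → ∑< n g + v + f i) (f≡g n ≤-refl (>⇒≢ i<n)) ⟩
    ∑< n g + g n + f i  ∎
    where open ≡-Reasoning

∑-vanishing : ∀ {f B} n → B ≤ n → (∀ b → B ≤ b → f b ≡ 0) → ∑< n f ≡ ∑< B f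
∑-vanishing n B≤n f≡0 with m≤n⇒m<n∨m≡n B≤n
∑-vanishing (suc n) _ f≡0 | inj₁ B<1+n =
  trans (cong₂ _+_ (∑-vanishing n (<⇒≤pred B<1+n) f≡0) (f≡0 n (<⇒≤pred B<1+n))) (+-identityʳ _)
∑-vanishing n _ f≡0 | inj₂ refl = refl

∑-update₂ : ∀ {f g} n {i j} → i ≢ j → i < n → j < n →
            (∀ a → a < n → a ≢ i → a ≢ j → f a ≡ g a) →
            ∑< n f + (g i + g j) ≡ ∑< n g + (f i + f j)
∑-update₂ {f} {g} n {i} {j} i≢j i<n j<n f≡g = begin
  ∑< n f + (g i + g j)           ≡⟨ +-assoc (∑< n f) _ _ ⟨
  ∑< n f + g i + g j             ≡⟨ cong (λ v → ∑< n f + v + g j) f[i≔g]-self ⟨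
  ∑< n f + f[i≔g] i + g j        ≡⟨ cong (_+ g j)
                                      (∑-update n i<n (λ a _ a≢i → sym (f[i≔g]-other a a≢i))) ⟩
  ∑< n f[i≔g] + f i + g j        ≡⟨ xy∙z≈xz∙y (∑< n f[i≔g]) (f i) (g j) ⟩
  ∑< n f[i≔g] + g j + f i        ≡⟨ cong (_+ f i) (∑-update n j<n f[i≔g]≡g) ⟩
  ∑< n g + f[i≔g] j + f i        ≡⟨ cong (λ v → ∑< n g + v + f i) (f[i≔g]-other j (i≢j ∘ sym)) ⟩
  ∑< n g + f j + f i             ≡⟨ +-assoc (∑< n g) _ _ ⟩
  ∑< n g + (f j + f i)           ≡⟨ cong (∑< n g +_) (+-comm (f j) (f i)) ⟩
  ∑< n g + (f i + f j)           ∎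
  where
  open ≡-Reasoning
  f[i≔g] : ℕ → ℕ
  f[i≔g] a with a ≟ i
  ... | yes _ = g a
  ... | no  _ = f a
  f[i≔g]-self : f[i≔g] i ≡ g i
  f[i≔g]-self with i ≟ i
  ... | yes _   = refl
  ... | no  i≢i = contradiction refl i≢i
  f[i≔g]-other : ∀ a → a ≢ i → f[i≔g] a ≡ f a
  f[i≔g]-other a a≢i with a ≟ i
  ... | yes a≡i = contradiction a≡i a≢i
  ... | no  _   = refl
  f[i≔g]≡g : ∀ a → a < n → a ≢ j → f[i≔g] a ≡ g a
  f[i≔g]≡g a a<n a≢j with a ≟ i
  ... | yes _   = refl
  ... | no  a≢i = f≡g a a<n a≢i a≢j

∑-indicator : ∀ n {j} → j < n → ∑[ b < n ] 𝟙 (b ≟ j) ≡ 1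
∑-indicator n {j} j<n = +-cancelʳ-≡ 0 _ _ (begin
  ∑[ b < n ] 𝟙 (b ≟ j) + 0  ≡⟨ ∑-update n j<n (λ a _ a≢j → 𝟙-no (a ≟ j) a≢j) ⟩
  ∑[ _ < n ] 0 + 𝟙 (j ≟ j)  ≡⟨ cong₂ _+_ (∑-zero n) (𝟙-yes (j ≟ j) refl) ⟩
  1 + 0                     ∎)
  where
  open ≡-Reasoning
  ∑-zero : ∀ n → ∑[ _ < n ] 0 ≡ 0
  ∑-zero zero    = refl
  ∑-zero (suc n) = trans (+-identityʳ _) (∑-zero n)

-- Counting in lists

sum-map-upTo : ∀ (f : ℕ → ℕ) n → sum (map f (upTo n)) ≡ ∑< n f
sum-map-upTo f zero    = refl
sum-map-upTo f (suc n) = begin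
  sum (map f (upTo (suc n)))          ≡⟨ cong (sum ∘ map f) (upTo-∷ʳ n) ⟨
  sum (map f (upTo n ∷ʳ n))           ≡⟨ cong sum (map-++ f (upTo n) (n ∷ [])) ⟩
  sum (map f (upTo n) ∷ʳ f n)         ≡⟨ sum-++ (map f (upTo n)) (f n ∷ []) ⟩
  sum (map f (upTo n)) + (f n + 0)    ≡⟨ cong₂ _+_ (sum-map-upTo f n) (+-identityʳ (f n)) ⟩
  ∑< n f + f n                        ∎
  where open ≡-Reasoning

length-filter-∷ : {P : ℕ → Set} (P? : Decidable P) (x : ℕ) (xs : List ℕ) →
                  length (filter P? (x ∷ xs)) ≡ 𝟙 (P? x) + length (filter P? xs)
length-filter-∷ P? x xs with P? x
... | yes _ = refl
... | no  _ = refl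

length-filter≡sum : {P : ℕ → Set} (P? : Decidable P) (xs : List ℕ) →
                    length (filter P? xs) ≡ sum (map (𝟙 ∘ P?) xs)
length-filter≡sum P? []       = refl
length-filter≡sum P? (x ∷ xs) =
  trans (length-filter-∷ P? x xs) (cong (𝟙 (P? x) +_) (length-filter≡sum P? xs))

filter-filter : {P Q : ℕ → Set} (P? : Decidable P) (Q? : Decidable Q) (xs : List ℕ) →
                filter Q? (filter P? xs) ≡ filter (λ x → P? x ×-dec Q? x) xs
filter-filter P? Q? []       = refl
filter-filter P? Q? (x ∷ xs) with P? x
... | no  _ = filter-filter P? Q? xs
... | yes _ with Q? x
...   | yes _ = cong (x ∷_) (filter-filter P? Q? xs)
...   | no  _ = filter-filter P? Q? xs

length-filter-upTo : {P : ℕ → Set} (P? : Decidable P) (n : ℕ) →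
                     length (filter P? (upTo n)) ≡ ∑[ a < n ] 𝟙 (P? a)
length-filter-upTo P? n = trans (length-filter≡sum P? (upTo n)) (sum-map-upTo (𝟙 ∘ P?) n)

count≥ : ℕ → List ℕ → ℕ
count≥ k xs = length (filter (k ≤?_) xs)

Pointwise⇒count≥-≤ : ∀ k {xs ys} → Pointwise _≤_ xs ys → count≥ k xs ≤ count≥ k ys
Pointwise⇒count≥-≤ k [] = z≤n
Pointwise⇒count≥-≤ k {x ∷ xs} {y ∷ ys} (x≤y ∷ xs≤ys) = begin
  count≥ k (x ∷ xs)          ≡⟨ length-filter-∷ (k ≤?_) x xs ⟩
  𝟙 (k ≤? x) + count≥ k xs   ≤⟨ +-mono-≤ (𝟙-mono (k ≤? x) (k ≤? y) (λ k≤x → ≤-trans k≤x x≤y))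
                                        (Pointwise⇒count≥-≤ k xs≤ys) ⟩
  𝟙 (k ≤? y) + count≥ k ys   ≡⟨ length-filter-∷ (k ≤?_) y ys ⟨
  count≥ k (y ∷ ys)          ∎
  where open ≤-Reasoning

count≥-all : ∀ {k xs} → All (k ≤_) xs → count≥ k xs ≡ length xs
count≥-all {k} all≥k = cong length (filter-all (k ≤?_) all≥k)

count≥-≤⇒Pointwise : ∀ {xs ys} → Linked _≤_ xs → Linked _≤_ ys → length xs ≡ length ys →
                      (∀ k → count≥ k xs ≤ count≥ k ys) → Pointwise _≤_ xs ys
count≥-≤⇒Pointwise {[]}     {[]}     _ _ _ _ = []
count≥-≤⇒Pointwise {a ∷ xs} {b ∷ ys} ↗a∷xs ↗b∷ys |a∷xs|≡|b∷ys| count≤ =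
  a≤b ∷ count≥-≤⇒Pointwise (Linked.tail ↗a∷xs) (Linked.tail ↗b∷ys) |xs|≡|ys| count≤-tail
  where
  |xs|≡|ys| : length xs ≡ length ys
  |xs|≡|ys| = suc-injective |a∷xs|≡|b∷ys|

  a≤b : a ≤ b
  a≤b with a ≤? b
  ... | yes a≤b = a≤b
  ... | no  a≰b = contradiction (begin
    suc (length xs)     ≡⟨ count≥-all (Linked⇒All ≤-trans ≤-refl ↗a∷xs) ⟨
    count≥ a (a ∷ xs)   ≤⟨ count≤ a ⟩
    count≥ a (b ∷ ys)   ≡⟨ cong length (filter-reject (a ≤?_) a≰b) ⟩
    count≥ a ys         ≤⟨ length-filter (a ≤?_) ys ⟩
    length ys           ≡⟨ |xs|≡|ys| ⟨
    length xs           ∎) (<-irrefl refl)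
    where open ≤-Reasoning

  count≤-tail : ∀ k → count≥ k xs ≤ count≥ k ys
  count≤-tail k with k ≤? b
  ... | yes k≤b = begin
    count≥ k xs   ≤⟨ length-filter (k ≤?_) xs ⟩
    length xs     ≡⟨ |xs|≡|ys| ⟩
    length ys     ≡⟨ count≥-all (All.tail (Linked⇒All ≤-trans k≤b ↗b∷ys)) ⟨
    count≥ k ys   ∎
    where open ≤-Reasoning
  ... | no  k≰b = begin
    count≥ k xs         ≡⟨ cong length (filter-reject (k ≤?_) (k≰b ∘ (λ k≤a → ≤-trans k≤a a≤b))) ⟨
    count≥ k (a ∷ xs)   ≤⟨ count≤ k ⟩
    count≥ k (b ∷ ys)   ≡⟨ cong length (filter-reject (k ≤?_) k≰b) ⟩
    count≥ k ys         ∎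
    where open ≤-Reasoning

-- Bruhat order via counts

above : (ℕ → ℕ) → ℕ → ℕ → ℕ
above f n k = ∑[ a < n ] 𝟙 (k ≤? f a)

infix 4 _⊑_

_⊑_ : (ℕ → ℕ) → (ℕ → ℕ) → Set
f ⊑ g = ∀ n k → above f n k ≤ above g n k

⊑-trans : ∀ {f g h} → f ⊑ g → g ⊑ h → f ⊑ h
⊑-trans f⊑g g⊑h n k = ≤-trans (f⊑g n k) (g⊑h n k)

count≥-sortedPrefix : ∀ τ n k → count≥ k (sortedPrefix τ n) ≡ above (fun τ) n k
count≥-sortedPrefix τ n k = begin
  count≥ k (sortedPrefix τ n)                      ≡⟨ ↭-length (filter-↭ (k ≤?_)
                                                                      (sort-↭ (map (fun τ) (upTo n)))) ⟩
  count≥ k (map (fun τ) (upTo n))                  ≡⟨ length-filter≡sum (k ≤?_) (map (fun τ) (upTo n)) ⟩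
  sum (map (𝟙 ∘ (k ≤?_)) (map (fun τ) (upTo n)))   ≡⟨ cong sum (map-∘ (upTo n)) ⟨
  sum (map (λ a → 𝟙 (k ≤? fun τ a)) (upTo n))      ≡⟨ sum-map-upTo (λ a → 𝟙 (k ≤? fun τ a)) n ⟩
  above (fun τ) n k                                ∎
  where open ≡-Reasoning

length-sortedPrefix : ∀ τ n → length (sortedPrefix τ n) ≡ n
length-sortedPrefix τ n =
  trans (↭-length (sort-↭ (map (fun τ) (upTo n)))) (trans (length-map (fun τ) (upTo n)) (length-upTo n))

≤B⇒⊑ : ∀ {σ ω} → σ ≤B ω → fun σ ⊑ fun ω
≤B⇒⊑ {σ} {ω} σ≤ω n k =
  subst₂ _≤_ (count≥-sortedPrefix σ n k) (count≥-sortedPrefix ω n k) (Pointwise⇒count≥-≤ k (σ≤ω n))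

⊑⇒≤B : ∀ {σ ω} → fun σ ⊑ fun ω → σ ≤B ω
⊑⇒≤B {σ} {ω} σ⊑ω n =
  count≥-≤⇒Pointwise (sort-↗ (map (fun σ) (upTo n))) (sort-↗ (map (fun ω) (upTo n)))
    (trans (length-sortedPrefix σ n) (sym (length-sortedPrefix ω n)))
    (λ k → subst₂ _≤_ (sym (count≥-sortedPrefix σ n k)) (sym (count≥-sortedPrefix ω n k)) (σ⊑ω n k))

⊑⇒≤-at-divergence : ∀ {f g i} → f ⊑ g → (∀ a → a < i → f a ≡ g a) → f i ≤ g i
⊑⇒≤-at-divergence {f} {g} {i} f⊑g prefix with f i ≤? g i
... | yes fi≤gi = fi≤gi
... | no  fi≰gi = contradiction (begin
  1 + above f i (f i)       ≡⟨ +-comm 1 _ ⟩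
  above f i (f i) + 1       ≡⟨ cong (above f i (f i) +_) (𝟙-yes (f i ≤? f i) ≤-refl) ⟨
  above f (suc i) (f i)     ≤⟨ f⊑g (suc i) (f i) ⟩
  above g (suc i) (f i)     ≡⟨ cong (above g i (f i) +_) (𝟙-no (f i ≤? g i) fi≰gi) ⟩
  above g i (f i) + 0       ≡⟨ +-identityʳ _ ⟩
  above g i (f i)           ≡⟨ ∑-cong i (λ a a<i → cong (λ v → 𝟙 (f i ≤? v)) (prefix a a<i)) ⟨
  above f i (f i)           ∎) 1+n≰n
  where open ≤-Reasoning

-- Exchanging two values

transpose : ℕ → ℕ → ℕ → ℕ
transpose i j b with b ≟ i | b ≟ j
... | yes _ | _     = j
... | no  _ | yes _ = i
... | no  _ | no  _ = b

transpose-left : ∀ i j → transpose i j i ≡ j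
transpose-left i j with i ≟ i | i ≟ j
... | yes _   | _ = refl
... | no  i≢i | _ = contradiction refl i≢i

transpose-right : ∀ i j → transpose i j j ≡ i
transpose-right i j with j ≟ i | j ≟ j
... | yes j≡i | _       = j≡i
... | no  _   | yes _   = refl
... | no  _   | no  j≢j = contradiction refl j≢j

transpose-other : ∀ {i j b} → b ≢ i → b ≢ j → transpose i j b ≡ b
transpose-other {i} {j} {b} b≢i b≢j with b ≟ i | b ≟ j
... | yes b≡i | _       = contradiction b≡i b≢i
... | no  _   | yes b≡j = contradiction b≡j b≢j
... | no  _   | no  _   = refl

transpose-involutive : ∀ i j b → transpose i j (transpose i j b) ≡ b
transpose-involutive i j b with b ≟ i | b ≟ j
... | yes refl | _        = transpose-right b j
... | no  _    | yes refl = transpose-left i b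
... | no  b≢i  | no  b≢j  = transpose-other b≢i b≢j

<-transpose : ∀ {i j a b} → a < i → a < j → a < b → a < transpose i j b
<-transpose {i} {j} {a} {b} a<i a<j a<b with b ≟ i | b ≟ j
... | yes _ | _     = a<j
... | no  _ | yes _ = a<i
... | no  _ | no  _ = a<b

_⟨_⇄_⟩ : Perm → ℕ → ℕ → Perm
τ ⟨ i ⇄ j ⟩ = record
  { fun     = fun τ ∘ transpose i j
  ; inv     = transpose i j ∘ inv τ
  ; inv∘fun = λ n → trans (cong (transpose i j) (inv∘fun τ _)) (transpose-involutive i j n)
  ; fun∘inv = λ n → trans (cong (fun τ) (transpose-involutive i j _)) (fun∘inv τ n)
  }

module _ (f : ℕ → ℕ) {i j} (i<j : i < j) where

  ∑-transpose-outside : ∀ n → ¬ (i < n × n ≤ j) → ∑[ a < n ] f (transpose i j a) ≡ ∑< n f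
  ∑-transpose-outside n outside with n ≤? i
  ... | yes n≤i = ∑-cong n λ a a<n →
    cong f (transpose-other (<⇒≢ (<-≤-trans a<n n≤i)) (<⇒≢ (<-trans (<-≤-trans a<n n≤i) i<j)))
  ... | no  n≰i = sym (+-cancelʳ-≡ _ _ _ (begin
    ∑< n f + (f i + f j)     ≡⟨ cong (∑< n f +_) (+-comm (f i) (f j)) ⟩
    ∑< n f + (f j + f i)     ≡⟨ cong (λ v → ∑< n f + v) (cong₂ _+_ (cong f (transpose-left i j))
                                                                  (cong f (transpose-right i j))) ⟨
    ∑< n f + (f (transpose i j i) + f (transpose i j j))
                             ≡⟨ ∑-update₂ n (<⇒≢ i<j) (<-trans i<j j<n) j<n
                                  (λ a _ a≢i a≢j → cong f (sym (transpose-other a≢i a≢j))) ⟩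
    ∑[ a < n ] f (transpose i j a) + (f i + f j) ∎))
    where
    open ≡-Reasoning
    j<n : j < n
    j<n = ≰⇒> (λ n≤j → outside (≰⇒> n≰i , n≤j))

  ∑-transpose-straddle : ∀ n → i < n → n ≤ j → ∑[ a < n ] f (transpose i j a) + f i ≡ ∑< n f + f j
  ∑-transpose-straddle n i<n n≤j =
    trans (∑-update n i<n (λ a a<n a≢i → cong f (transpose-other a≢i (<⇒≢ (<-≤-trans a<n n≤j)))))
          (cong (λ v → ∑< n f + f v) (transpose-left i j))

⊑-transpose : ∀ {f i j} → i < j → f i < f j → f ⊑ f ∘ transpose i j
⊑-transpose {f} {i} {j} i<j fi<fj n k with (i <? n) ×-dec (n ≤? j)
... | no  outside         = ≤-reflexive (sym (∑-transpose-outside (λ a → 𝟙 (k ≤? f a)) i<j n outside))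
... | yes (i<n , n≤j) = +-cancelʳ-≤ (𝟙 (k ≤? f i)) _ _ (begin
  above f n k + 𝟙 (k ≤? f i)                   ≤⟨ +-monoʳ-≤ (above f n k) (𝟙-mono (k ≤? f i) (k ≤? f j)
                                                     (λ k≤fi → ≤-trans k≤fi (<⇒≤ fi<fj))) ⟩
  above f n k + 𝟙 (k ≤? f j)                   ≡⟨ ∑-transpose-straddle (λ a → 𝟙 (k ≤? f a)) i<j n i<n n≤j ⟨
  above (f ∘ transpose i j) n k + 𝟙 (k ≤? f i) ∎)
  where open ≤-Reasoning

above-transpose-< : ∀ {f i j} → i < j → f i < f j →
                    above f (suc i) (f j) < above (f ∘ transpose i j) (suc i) (f j)
above-transpose-< {f} {i} {j} i<j fi<fj = begin-strict
  above f (suc i) (f j)                                     <⟨ n<1+n _ ⟩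
  1 + above f (suc i) (f j)                                 ≡⟨ +-comm 1 _ ⟩
  above f (suc i) (f j) + 1                                 ≡⟨ cong (above f (suc i) (f j) +_)
                                                                    (𝟙-yes (f j ≤? f j) ≤-refl) ⟨
  above f (suc i) (f j) + 𝟙 (f j ≤? f j)                    ≡⟨ ∑-transpose-straddle (λ a → 𝟙 (f j ≤? f a))
                                                                    i<j (suc i) ≤-refl i<j ⟨
  above (f ∘ transpose i j) (suc i) (f j) + 𝟙 (f j ≤? f i)  ≡⟨ cong (above (f ∘ transpose i j) (suc i) (f j) +_)
                                                                    (𝟙-no (f j ≤? f i) (<⇒≱ fi<fj)) ⟩
  above (f ∘ transpose i j) (suc i) (f j) + 0               ≡⟨ +-identityʳ _ ⟩
  above (f ∘ transpose i j) (suc i) (f j)                   ∎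
  where open ≤-Reasoning

band : (ℕ → ℕ) → ℕ → ℕ → ℕ → ℕ
band f n k l = ∑[ a < n ] 𝟙 ((f a ≤? l) ×-dec (k ≤? f a))

above-split : ∀ f n {k l} → k ≤ suc l → above f n k ≡ above f n (suc l) + band f n k l
above-split f n {k} {l} k≤1+l = trans (∑-cong n (λ a _ → split (f a))) (∑-distrib-+ n)
  where
  split : ∀ v → 𝟙 (k ≤? v) ≡ 𝟙 (suc l ≤? v) + 𝟙 ((v ≤? l) ×-dec (k ≤? v))
  split v with v ≤? l
  ... | yes v≤l = sym (cong₂ _+_ (𝟙-no (suc l ≤? v) (<⇒≱ (s≤s v≤l)))
                                 (𝟙-×-yes (v ≤? l) (k ≤? v) v≤l))
  ... | no  v≰l = trans (𝟙-yes (k ≤? v) (≤-trans k≤1+l (≰⇒> v≰l)))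
                        (sym (cong₂ _+_ (𝟙-yes (suc l ≤? v) (≰⇒> v≰l))
                                        (𝟙-×-no (v ≤? l) (k ≤? v) v≰l)))

-- Above the threshold g i + 1 the counts are compared by f ⊑ g; in the band [k, g i] the
-- function f has no entry from position i on, while g has its entry at i.
⊑-band : ∀ {f g i n k} → f ⊑ g → (∀ a → a < i → f a ≡ g a) → i < n → f i < k → k ≤ g i →
         (∀ c → i < c → c < n → f c < k ⊎ g i < f c) → suc (above f n k) ≤ above g n k
⊑-band {f} {g} {i} {n} {k} f⊑g prefix i<n fi<k k≤gi outside = begin
  suc (above f n k)                         ≡⟨ cong suc (above-split f n k≤1+l) ⟩
  suc (above f n (suc l) + band f n k l)    ≡⟨ +-suc (above f n (suc l)) (band f n k l) ⟨
  above f n (suc l) + suc (band f n k l)    ≤⟨ +-mono-≤ (f⊑g n (suc l)) band-< ⟩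
  above g n (suc l) + band g n k l          ≡⟨ above-split g n k≤1+l ⟨
  above g n k                               ∎
  where
  open ≤-Reasoning
  l : ℕ
  l = g i
  k≤1+l : k ≤ suc l
  k≤1+l = m≤n⇒m≤1+n k≤gi
  inBand : (ℕ → ℕ) → ℕ → ℕ
  inBand h a = 𝟙 ((h a ≤? l) ×-dec (k ≤? h a))

  f-outside-band : ∀ a → i ≤ a → a < n → inBand f a ≡ 0
  f-outside-band a i≤a a<n = 𝟙-no ((f a ≤? l) ×-dec (k ≤? f a)) λ (fa≤l , k≤fa) →
    excluded fa≤l k≤fa (m≤n⇒m<n∨m≡n i≤a)
    where
    excluded : f a ≤ l → k ≤ f a → i < a ⊎ i ≡ a → ⊥
    excluded fa≤l k≤fa (inj₂ refl) = <⇒≱ fi<k k≤fa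
    excluded fa≤l k≤fa (inj₁ i<a) with outside a i<a a<n
    ... | inj₁ fa<k = <⇒≱ fa<k k≤fa
    ... | inj₂ l<fa = <⇒≱ l<fa fa≤l

  band-< : band f n k l < band g n k l
  band-< = ∑-mono-< n inBand-≤ i<n (begin-strict
    inBand f i  ≡⟨ f-outside-band i ≤-refl i<n ⟩
    0           <⟨ s≤s z≤n ⟩
    1           ≡⟨ 𝟙-yes ((g i ≤? l) ×-dec (k ≤? g i)) (≤-refl , k≤gi) ⟨
    inBand g i  ∎)
    where
    inBand-≤ : ∀ a → a < n → inBand f a ≤ inBand g a
    inBand-≤ a a<n with a <? i
    ... | yes a<i = ≤-reflexive (cong (λ v → 𝟙 ((v ≤? l) ×-dec (k ≤? v))) (prefix a a<i))
    ... | no  a≮i = ≤-trans (≤-reflexive (f-outside-band a (≮⇒≥ a≮i) a<n)) z≤n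

transpose-⊑ : ∀ {f g i j} → f ⊑ g → (∀ a → a < i → f a ≡ g a) →
              i < j → f i < f j → f j ≤ g i → (∀ c → i < c → c < j → f c < f i ⊎ g i < f c) →
              f ∘ transpose i j ⊑ g
transpose-⊑ {f} {g} {i} {j} f⊑g prefix i<j fi<fj fj≤gi between n k with (i <? n) ×-dec (n ≤? j)
... | no outside =
  subst (_≤ above g n k) (sym (∑-transpose-outside (λ a → 𝟙 (k ≤? f a)) i<j n outside)) (f⊑g n k)
... | yes (i<n , n≤j) with (f i <? k) ×-dec (k ≤? f j)
                        | ∑-transpose-straddle (λ a → 𝟙 (k ≤? f a)) i<j n i<n n≤j
...   | yes (fi<k , k≤fj) | straddle = begin
  above (f ∘ transpose i j) n k                ≡⟨ +-identityʳ _ ⟨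
  above (f ∘ transpose i j) n k + 0            ≡⟨ cong (above (f ∘ transpose i j) n k +_)
                                                       (𝟙-no (k ≤? f i) (<⇒≱ fi<k)) ⟨
  above (f ∘ transpose i j) n k + 𝟙 (k ≤? f i) ≡⟨ straddle ⟩
  above f n k + 𝟙 (k ≤? f j)      ≡⟨ cong (above f n k +_) (𝟙-yes (k ≤? f j) k≤fj) ⟩
  above f n k + 1                 ≡⟨ +-comm (above f n k) 1 ⟩
  suc (above f n k)               ≤⟨ ⊑-band f⊑g prefix i<n fi<k (≤-trans k≤fj fj≤gi) (λ c i<c c<n →
                                       [ (λ fc<fi → inj₁ (<-trans fc<fi fi<k)) , inj₂ ]′
                                         (between c i<c (<-≤-trans c<n n≤j))) ⟩
  above g n k                     ∎
  where open ≤-Reasoning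
...   | no notInBand | straddle = begin
  above (f ∘ transpose i j) n k   ≡⟨ +-cancelʳ-≡ _ _ _ (trans straddle (cong (above f n k +_)
                                       (𝟙-cong (k ≤? f j) (k ≤? f i)
                                          (λ k≤fj → ≮⇒≥ (λ fi<k → notInBand (fi<k , k≤fj)))
                                          (λ k≤fi → ≤-trans k≤fi (<⇒≤ fi<fj))))) ⟩
  above f n k                     ≤⟨ f⊑g n k ⟩
  above g n k                     ∎
  where open ≤-Reasoning

-- Inversions and length

≤-maxList : ∀ {x xs} → x ∈ xs → x ≤ maxList xs
≤-maxList (here refl)  = m≤m⊔n _ _
≤-maxList (there x∈xs) = ≤-trans (≤-maxList x∈xs) (m≤n⊔m _ _)

≤-maxList-upTo : ∀ f {n a} → a < n → f a ≤ maxList (map f (upTo n))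
≤-maxList-upTo f a<n = ≤-maxList (∈-map⁺ f (∈-upTo⁺ a<n))

bound-spec : ∀ τ a b → bound τ a ≤ b → fun τ a ≤ fun τ b
bound-spec τ a b bound≤b with fun τ b <? fun τ a
... | no  τb≮τa = ≮⇒≥ τb≮τa
... | yes τb<τa = contradiction bound≤b
                    (<⇒≱ (s≤s (subst (_≤ _) (inv∘fun τ b) (≤-maxList-upTo (inv τ) τb<τa))))

inversion : Perm → ℕ → ℕ → ℕ
inversion τ a b = 𝟙 ((a <? b) ×-dec (fun τ b <? fun τ a))

inversion-< : ∀ τ {a b} → a < b → inversion τ a b ≡ 𝟙 (fun τ b <? fun τ a)
inversion-< τ {a} {b} = 𝟙-×-yes (a <? b) (fun τ b <? fun τ a)

inversion-≮ : ∀ τ {a b} → ¬ a < b → inversion τ a b ≡ 0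
inversion-≮ τ {a} {b} = 𝟙-×-no (a <? b) (fun τ b <? fun τ a)

Dcard≡∑ : ∀ τ a → Dcard τ a ≡ ∑[ b < bound τ a ] inversion τ a b
Dcard≡∑ τ a = trans (cong length (filter-filter (a <?_) (λ b → fun τ b <? fun τ a) (upTo (bound τ a))))
                    (length-filter-upTo _ (bound τ a))

Dcard-∑ : ∀ τ a B → (∀ b → B ≤ b → fun τ a ≤ fun τ b) →
          Dcard τ a ≡ ∑[ b < B ] inversion τ a b
Dcard-∑ τ a B eventually≤ = begin
  Dcard τ a                                   ≡⟨ Dcard≡∑ τ a ⟩
  ∑[ b < bound τ a ] inversion τ a b          ≡⟨ ∑-vanishing (bound τ a ⊔ B) (m≤m⊔n (bound τ a) B)
                                                   (λ b le → vanishes b (bound-spec τ a b le)) ⟨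
  ∑[ b < bound τ a ⊔ B ] inversion τ a b      ≡⟨ ∑-vanishing (bound τ a ⊔ B) (m≤n⊔m (bound τ a) B)
                                                   (λ b le → vanishes b (eventually≤ b le)) ⟩
  ∑[ b < B ] inversion τ a b                  ∎
  where
  open ≡-Reasoning
  vanishes : ∀ b → fun τ a ≤ fun τ b → inversion τ a b ≡ 0
  vanishes b τa≤τb = 𝟙-no ((a <? b) ×-dec (fun τ b <? fun τ a)) λ (_ , τb<τa) → <⇒≱ τb<τa τa≤τb

ℓ≡∑ : ∀ m τ → ℓ m τ ≡ ∑< (suc m) (Dcard τ)
ℓ≡∑ m τ = sum-map-upTo (Dcard τ) (suc m)

ℓ-cong : ∀ {x y} m → x ≐ y → ℓ m x ≡ ℓ m y
ℓ-cong {x} {y} m x≐y =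
  trans (ℓ≡∑ m x) (trans (∑-cong (suc m) (λ a _ → Dcard-cong a)) (sym (ℓ≡∑ m y)))
  where
  Dcard-cong : ∀ a → Dcard x a ≡ Dcard y a
  Dcard-cong a = begin
    Dcard x a                            ≡⟨ Dcard≡∑ x a ⟩
    ∑[ b < bound x a ] inversion x a b   ≡⟨ ∑-cong (bound x a) (λ b _ →
                                              cong₂ (λ u v → 𝟙 ((a <? b) ×-dec (u <? v))) (x≐y b) (x≐y a)) ⟩
    ∑[ b < bound x a ] inversion y a b   ≡⟨ Dcard-∑ y a (bound x a)
                                              (λ b le → subst₂ _≤_ (x≐y a) (x≐y b) (bound-spec x a b le)) ⟨
    Dcard y a                            ∎
    where open ≡-Reasoning

Eventually : (ℕ → Set) → Set
Eventually P = ∃ λ N → ∀ m → N ≤ m → P m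

eventually-map : ∀ {P Q : ℕ → Set} → (∀ {m} → P m → Q m) → Eventually P → Eventually Q
eventually-map f (N , p) = N , λ m N≤m → f (p m N≤m)

eventually-zipWith : ∀ {P Q R : ℕ → Set} → (∀ {m} → P m → Q m → R m) →
                     Eventually P → Eventually Q → Eventually R
eventually-zipWith f (M , p) (N , q) =
  M ⊔ N , λ m le → f (p m (m⊔n≤o⇒m≤o M N le)) (q m (m⊔n≤o⇒n≤o M N le))

record LengthDiff (x y : Perm) (k : ℕ) : Set where
  constructor lengthDiff
  field eventually : Eventually λ m → ℓ m y ≡ ℓ m x + k

lengthDiff-≐ : ∀ {x y} → x ≐ y → LengthDiff x y 0
lengthDiff-≐ {x} {y} x≐y =
  lengthDiff (0 , λ m _ → trans (sym (ℓ-cong {x} {y} m x≐y)) (sym (+-identityʳ _)))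

lengthDiff-trans : ∀ {x y z k l} → LengthDiff x y k → LengthDiff y z l → LengthDiff x z (k + l)
lengthDiff-trans {x} {k = k} {l} (lengthDiff d₁) (lengthDiff d₂) = lengthDiff (eventually-zipWith
  (λ {m} y≡x+k z≡y+l → trans z≡y+l (trans (cong (_+ l) y≡x+k) (+-assoc (ℓ m x) k l))) d₁ d₂)

lengthDiff-unique : ∀ {x y k l} → LengthDiff x y k → LengthDiff x y l → k ≡ l
lengthDiff-unique (lengthDiff d₁) (lengthDiff d₂)
  with eventually-zipWith (λ e₁ e₂ → +-cancelˡ-≡ _ _ _ (trans (sym e₁) e₂)) d₁ d₂
... | N , k≡l = k≡l N ≤-refl

lengthDiff-suc⇒≢ : ∀ {x y k} → LengthDiff x y (suc k) → ¬ (x ≐ y)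
lengthDiff-suc⇒≢ {x} {y} d x≐y with lengthDiff-unique (lengthDiff-≐ {x} {y} x≐y) d
... | ()

module _ (x : Perm) {i j : ℕ} (i<j : i < j) (xi<xj : fun x i < fun x j)
         (between : ∀ c → i < c → c < j → fun x c < fun x i ⊎ fun x j < fun x c) where

  private
    X : ℕ → ℕ
    X = fun x
    π : ℕ → ℕ
    π = transpose i j
    x′ : Perm
    x′ = x ⟨ i ⇄ j ⟩
    lt : ℕ → ℕ → ℕ
    lt u v = 𝟙 (X u <? X v)

    π-beyond-j : ∀ {b} → j < b → π b ≡ b
    π-beyond-j j<b = transpose-other (>⇒≢ (<-trans i<j j<b)) (>⇒≢ j<b)

    Dcard-transposed : ∀ a B → bound x (π a) ≤ B → j < B → Dcard x′ a ≡ ∑[ b < B ] inversion x′ a b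
    Dcard-transposed a B bound≤B j<B = Dcard-∑ x′ a B λ b B≤b →
      subst (X (π a) ≤_) (cong X (sym (π-beyond-j (<-≤-trans j<B B≤b))))
            (bound-spec x (π a) b (≤-trans bound≤B B≤b))

    inversion-left : ∀ {a} → a < i → ∀ b → inversion x′ a b ≡ inversion x a (π b)
    inversion-left {a} a<i b =
      𝟙-cong ((a <? b) ×-dec (X (π b) <? X (π a))) ((a <? π b) ×-dec (X (π b) <? X a))
        (λ (a<b , inverted) → <-transpose a<i a<j a<b , subst (λ v → X (π b) < X v) πa≡a inverted)
        (λ (a<πb , inverted) → subst (a <_) (transpose-involutive i j b) (<-transpose a<i a<j a<πb)
                             , subst (λ v → X (π b) < X v) (sym πa≡a) inverted)
      where
      a<j : a < j
      a<j = <-trans a<i i<j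
      πa≡a : π a ≡ a
      πa≡a = transpose-other (<⇒≢ a<i) (<⇒≢ a<j)

    inversion-right : ∀ {a} → i < a → a ≢ j → ∀ b → inversion x′ a b ≡ inversion x a b
    inversion-right {a} i<a a≢j b with a <? b
    ... | no  a≮b = trans (inversion-≮ x′ a≮b) (sym (inversion-≮ x a≮b))
    ... | yes a<b = begin
      inversion x′ a b        ≡⟨ inversion-< x′ a<b ⟩
      lt (π b) (π a)          ≡⟨ cong (lt (π b)) (transpose-other (>⇒≢ i<a) a≢j) ⟩
      lt (π b) a              ≡⟨ lt-πb (<-cmp b j) ⟩
      lt b a                  ≡⟨ inversion-< x a<b ⟨
      inversion x a b         ∎
      where
      open ≡-Reasoning
      i<b : i < b
      i<b = <-trans i<a a<b
      lt-πb : Tri (b < j) (b ≡ j) (j < b) → lt (π b) a ≡ lt b a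
      lt-πb (tri< b<j b≢j _) = cong (λ v → lt v a) (transpose-other (>⇒≢ i<b) b≢j)
      lt-πb (tri> _ _ j<b)   = cong (λ v → lt v a) (π-beyond-j j<b)
      lt-πb (tri≈ _ refl _)  = trans (cong (λ v → lt v a) (transpose-right i j))
        (𝟙-cong (X i <? X a) (X j <? X a)
          (λ xi<xa → [ (λ xa<xi → contradiction xa<xi (<⇒≯ xi<xa)) , id ]′ (between a i<a a<b))
          (λ xj<xa → <-trans xi<xj xj<xa))

    inversion-ij : ∀ b → inversion x′ i b + inversion x′ j b
                       ≡ 𝟙 (b ≟ j) + (inversion x i b + inversion x j b)
    inversion-ij b with <-cmp b j
    ... | tri> _ b≢j j<b
      rewrite inversion-< x′ (<-trans i<j j<b) | inversion-< x′ j<b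
            | inversion-< x (<-trans i<j j<b) | inversion-< x j<b
            | π-beyond-j j<b | transpose-left i j | transpose-right i j | 𝟙-no (b ≟ j) b≢j
            = +-comm (lt b j) (lt b i)
    ... | tri≈ _ refl _
      rewrite inversion-< x′ i<j | inversion-≮ x′ (n≮n j) | inversion-< x i<j | inversion-≮ x (n≮n j)
            | transpose-left i j | transpose-right i j | 𝟙-yes (j ≟ j) refl
            | 𝟙-yes (X i <? X j) xi<xj | 𝟙-no (X j <? X i) (<⇒≯ xi<xj)
            = refl
    ... | tri< b<j b≢j _ with i <? b
    ...   | no  i≮b
      rewrite inversion-≮ x′ i≮b | inversion-≮ x′ (<⇒≯ b<j)
            | inversion-≮ x i≮b | inversion-≮ x (<⇒≯ b<j) | 𝟙-no (b ≟ j) b≢j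
            = refl
    ...   | yes i<b
      rewrite inversion-< x′ i<b | inversion-≮ x′ (<⇒≯ b<j)
            | inversion-< x i<b | inversion-≮ x (<⇒≯ b<j)
            | transpose-other (>⇒≢ i<b) b≢j | transpose-left i j | 𝟙-no (b ≟ j) b≢j
            = cong (_+ 0) (𝟙-cong (X b <? X j) (X b <? X i)
                ([ const , (λ xj<xb xb<xj → contradiction xb<xj (<⇒≯ xj<xb)) ]′ (between b i<b b<j))
                (λ xb<xi → <-trans xb<xi xi<xj))

    Dcard-transpose-other : ∀ a → a ≢ i → a ≢ j → Dcard x′ a ≡ Dcard x a
    Dcard-transpose-other a a≢i a≢j = begin
      Dcard x′ a                    ≡⟨ Dcard-transposed a B (subst (_≤ B) (cong (bound x) (sym πa≡a))
                                                                  (m≤m⊔n (bound x a) (suc j))) j<B ⟩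
      ∑[ b < B ] inversion x′ a b   ≡⟨ same-rows (<-cmp a i) ⟩
      ∑[ b < B ] inversion x a b    ≡⟨ Dcard-∑ x a B (λ b le →
                                           bound-spec x a b (m⊔n≤o⇒m≤o (bound x a) (suc j) le)) ⟨
      Dcard x a                     ∎
      where
      open ≡-Reasoning
      B : ℕ
      B = bound x a ⊔ suc j
      j<B : j < B
      j<B = m≤n⊔m (bound x a) (suc j)
      πa≡a : π a ≡ a
      πa≡a = transpose-other a≢i a≢j
      same-rows : Tri (a < i) (a ≡ i) (i < a) → ∑[ b < B ] inversion x′ a b ≡ ∑[ b < B ] inversion x a b
      same-rows (tri< a<i _ _) = trans (∑-cong B (λ b _ → inversion-left a<i b))
                                       (∑-transpose-outside (inversion x a) i<j B (λ (_ , B≤j) → <⇒≱ j<B B≤j))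
      same-rows (tri≈ _ a≡i _) = contradiction a≡i a≢i
      same-rows (tri> _ _ i<a) = ∑-cong B (λ b _ → inversion-right i<a a≢j b)

    Dcard-transpose-ij : Dcard x′ i + Dcard x′ j ≡ suc (Dcard x i + Dcard x j)
    Dcard-transpose-ij = begin
      Dcard x′ i + Dcard x′ j
        ≡⟨ cong₂ _+_
             (Dcard-transposed i B (subst (_≤ B) (cong (bound x) (sym (transpose-left i j))) bound-j≤B) j<B)
             (Dcard-transposed j B (subst (_≤ B) (cong (bound x) (sym (transpose-right i j))) bound-i≤B) j<B) ⟩
      ∑[ b < B ] inversion x′ i b + ∑[ b < B ] inversion x′ j b
        ≡⟨ ∑-distrib-+ B ⟨
      ∑[ b < B ] (inversion x′ i b + inversion x′ j b)
        ≡⟨ ∑-cong B (λ b _ → inversion-ij b) ⟩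
      ∑[ b < B ] (𝟙 (b ≟ j) + (inversion x i b + inversion x j b))
        ≡⟨ ∑-distrib-+ B ⟩
      ∑[ b < B ] 𝟙 (b ≟ j) + ∑[ b < B ] (inversion x i b + inversion x j b)
        ≡⟨ cong₂ _+_ (∑-indicator B j<B) (∑-distrib-+ B) ⟩
      1 + (∑[ b < B ] inversion x i b + ∑[ b < B ] inversion x j b)
        ≡⟨ cong (1 +_) (cong₂ _+_ (Dcard-∑ x i B (λ b le → bound-spec x i b (≤-trans bound-i≤B le)))
                                  (Dcard-∑ x j B (λ b le → bound-spec x j b (≤-trans bound-j≤B le)))) ⟨
      suc (Dcard x i + Dcard x j)
        ∎
      where
      open ≡-Reasoning
      B : ℕ
      B = bound x i ⊔ bound x j ⊔ suc j
      j<B : j < B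
      j<B = m≤n⊔m (bound x i ⊔ bound x j) (suc j)
      bound-i≤B : bound x i ≤ B
      bound-i≤B = ≤-trans (m≤m⊔n (bound x i) (bound x j)) (m≤m⊔n (bound x i ⊔ bound x j) (suc j))
      bound-j≤B : bound x j ≤ B
      bound-j≤B = ≤-trans (m≤n⊔m (bound x i) (bound x j)) (m≤m⊔n (bound x i ⊔ bound x j) (suc j))

  lengthDiff-transpose : LengthDiff x (x ⟨ i ⇄ j ⟩) 1
  lengthDiff-transpose = lengthDiff (j , λ m j≤m → +-cancelʳ-≡ F _ _ (begin
    ℓ m x′ + F                                        ≡⟨ cong (_+ F) (ℓ≡∑ m x′) ⟩
    ∑< (suc m) (Dcard x′) + F                         ≡⟨ ∑-update₂ (suc m) (<⇒≢ i<j)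
                                                           (<-≤-trans i<j (m≤n⇒m≤1+n j≤m)) (s≤s j≤m)
                                                           (λ a _ → Dcard-transpose-other a) ⟩
    ∑< (suc m) (Dcard x) + (Dcard x′ i + Dcard x′ j)  ≡⟨ cong (∑< (suc m) (Dcard x) +_) Dcard-transpose-ij ⟩
    ∑< (suc m) (Dcard x) + (1 + F)                    ≡⟨ +-assoc (∑< (suc m) (Dcard x)) 1 F ⟨
    ∑< (suc m) (Dcard x) + 1 + F                      ≡⟨ cong (λ v → v + 1 + F) (ℓ≡∑ m x) ⟨
    ℓ m x + 1 + F                                     ∎))
    where
    open ≡-Reasoning
    F : ℕ
    F = Dcard x i + Dcard x j

-- The exchange step

Least : (ℕ → Set) → ℕ → Set
Least P m = P m × (∀ c → c < m → ¬ P c)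

leastBelow? : ∀ {P : ℕ → Set} → Decidable P → ∀ n →
              (∃ λ m → m < n × Least P m) ⊎ (∀ c → c < n → ¬ P c)
leastBelow? P? zero = inj₂ λ _ ()
leastBelow? {P} P? (suc n) with leastBelow? P? n | P? n
... | inj₁ (m , m<n , least) | _      = inj₁ (m , m<n⇒m<1+n m<n , least)
... | inj₂ none              | yes pn = inj₁ (n , ≤-refl , pn , none)
... | inj₂ none              | no ¬pn = inj₂ λ c c<1+n →
  [ none c , (λ c≡n pc → ¬pn (subst P c≡n pc)) ]′ (m<1+n⇒m<n∨m≡n c<1+n)

least : ∀ {P : ℕ → Set} → Decidable P → ∀ {n} → P n → ∃ λ m → m ≤ n × Least P m
least P? {n} pn with leastBelow? P? (suc n)
... | inj₁ (m , m<1+n , least-m) = m , <⇒≤pred m<1+n , least-m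
... | inj₂ none                  = contradiction pn (none n ≤-refl)

fun-injective : ∀ τ {a b} → fun τ a ≡ fun τ b → a ≡ b
fun-injective τ {a} {b} τa≡τb = trans (sym (inv∘fun τ a)) (trans (cong (inv τ) τa≡τb) (inv∘fun τ b))

Agree : ℕ → Perm → Perm → Set
Agree M x y = ∀ n → M ≤ n → fun x n ≡ fun y n

DivergesAt : Perm → Perm → ℕ → Set
DivergesAt x y i = fun x i ≢ fun y i × (∀ a → a < i → fun x a ≡ fun y a)

firstDifference : ∀ {M x y} → Agree M x y → x ≐ y ⊎ ∃ λ i → i < M × DivergesAt x y i
firstDifference {M} {x} {y} agree with leastBelow? (λ a → ¬? (fun x a ≟ fun y a)) M
... | inj₁ (i , i<M , xi≢yi , before) =
  inj₂ (i , i<M , xi≢yi , λ a a<i → decidable-stable (fun x a ≟ fun y a) (before a a<i))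
... | inj₂ none = inj₁ x≐y
  where
  x≐y : x ≐ y
  x≐y n with n <? M
  ... | yes n<M = decidable-stable (fun x n ≟ fun y n) (none n n<M)
  ... | no  n≮M = agree n (≮⇒≥ n≮M)

record ExchangePartner (x y : Perm) (M i : ℕ) : Set where
  field
    j       : ℕ
    i<j     : i < j
    j<M     : j < M
    xi<xj   : fun x i < fun x j
    xj≤yi   : fun x j ≤ fun y i
    between : ∀ c → i < c → c < j → fun x c < fun x i ⊎ fun y i < fun x c

-- j is the first position after i with value in (x i, y i]; there is one, as x takes the value y i
-- at a position after i.
exchangePartner : ∀ {M x y i} → Agree M x y → (∀ a → a < i → fun x a ≡ fun y a) → fun x i < fun y i →
                  ExchangePartner x y M i
exchangePartner {M} {x} {y} {i} agree prefix xi<yi = record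
  { j = j ; i<j = i<j ; j<M = ≤-<-trans j≤J J<M ; xi<xj = xi<xj ; xj≤yi = xj≤yi ; between = between }
  where
  J : ℕ
  J = inv x (fun y i)
  xJ≡yi : fun x J ≡ fun y i
  xJ≡yi = fun∘inv x (fun y i)
  yJ≡yi⇒J≡i : fun y J ≡ fun y i → J ≡ i
  yJ≡yi⇒J≡i = fun-injective y

  i<J : i < J
  i<J with <-cmp i J
  ... | tri< i<J _ _  = i<J
  ... | tri≈ _ i≡J _  = contradiction (trans (cong (fun x) i≡J) xJ≡yi) (<⇒≢ xi<yi)
  ... | tri> _ _ J<i  = contradiction (yJ≡yi⇒J≡i (trans (sym (prefix J J<i)) xJ≡yi)) (<⇒≢ J<i)

  J<M : J < M
  J<M = ≰⇒> λ M≤J → >⇒≢ i<J (yJ≡yi⇒J≡i (trans (sym (agree J M≤J)) xJ≡yi))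

  InRange : ℕ → Set
  InRange b = i < b × fun x i < fun x b × fun x b ≤ fun y i

  first : ∃ λ m → m ≤ J × Least InRange m
  first = least (λ b → (i <? b) ×-dec ((fun x i <? fun x b) ×-dec (fun x b ≤? fun y i)))
                (i<J , subst (fun x i <_) (sym xJ≡yi) xi<yi , ≤-reflexive xJ≡yi)
  j : ℕ
  j = proj₁ first
  j≤J : j ≤ J
  j≤J = proj₁ (proj₂ first)
  least-j : Least InRange j
  least-j = proj₂ (proj₂ first)
  i<j : i < j
  i<j = proj₁ (proj₁ least-j)
  xi<xj : fun x i < fun x j
  xi<xj = proj₁ (proj₂ (proj₁ least-j))
  xj≤yi : fun x j ≤ fun y i
  xj≤yi = proj₂ (proj₂ (proj₁ least-j))

  between : ∀ c → i < c → c < j → fun x c < fun x i ⊎ fun y i < fun x c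
  between c i<c c<j with fun x c <? fun x i | fun y i <? fun x c
  ... | yes xc<xi | _         = inj₁ xc<xi
  ... | no  _     | yes yi<xc = inj₂ yi<xc
  ... | no  xc≮xi | no  yi≮xc = contradiction
    (i<c , ≤∧≢⇒< (≮⇒≥ xc≮xi) (<⇒≢ i<c ∘ fun-injective x) , ≮⇒≥ yi≮xc)
    (proj₂ least-j c c<j)

-- Monotone for ⊑ and strictly increased by each exchange step towards y: the termination
-- measure for building exchange paths.
potential : ℕ → Perm → (ℕ → ℕ) → ℕ
potential M y f = ∑[ n < suc M ] ∑[ k < suc (maxList (map (fun y) (upTo M))) ] above f n k

potential-mono : ∀ {M y f g} → f ⊑ g → potential M y f ≤ potential M y g
potential-mono {M} {y} f⊑g =
  ∑-mono-≤ (suc M) λ n _ → ∑-mono-≤ (suc (maxList (map (fun y) (upTo M)))) λ k _ → f⊑g n k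

potential-mono-< : ∀ {M y f g n k} → f ⊑ g → n ≤ M → k ≤ maxList (map (fun y) (upTo M)) →
                   above f n k < above g n k → potential M y f < potential M y g
potential-mono-< {M} {y} {n = n} f⊑g n≤M k≤max fewer =
  ∑-mono-< (suc M) (λ n _ → ∑-mono-≤ K λ k _ → f⊑g n k) (s≤s n≤M)
    (∑-mono-< K (λ k _ → f⊑g n k) (s≤s k≤max) fewer)
  where
  K : ℕ
  K = suc (maxList (map (fun y) (upTo M)))

record Step (M : ℕ) (x y : Perm) : Set where
  field
    next       : Perm
    x⊑next     : fun x ⊑ fun next
    next⊑y     : fun next ⊑ fun y
    agree      : Agree M next x
    longer     : LengthDiff x next 1
    progress   : potential M y (fun x) < potential M y (fun next)

exchangeStep : ∀ {M x y i} → Agree M x y → fun x ⊑ fun y → i < M → DivergesAt x y i → Step M x y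
exchangeStep {M} {x} {y} {i} agree x⊑y i<M (xi≢yi , prefix) = record
  { next       = x ⟨ i ⇄ j ⟩
  ; x⊑next     = ⊑-transpose i<j xi<xj
  ; next⊑y     = transpose-⊑ x⊑y prefix i<j xi<xj xj≤yi between
  ; agree      = λ n M≤n → cong (fun x)
                   (transpose-other (>⇒≢ (<-≤-trans i<M M≤n)) (>⇒≢ (<-≤-trans j<M M≤n)))
  ; longer     = lengthDiff-transpose x i<j xi<xj λ c i<c c<j →
                   Sum.map₂ (≤-<-trans xj≤yi) (between c i<c c<j)
  ; progress   = potential-mono-< {M} {y} (⊑-transpose {fun x} i<j xi<xj) i<M
                   (≤-trans xj≤yi (≤-maxList-upTo (fun y) i<M)) (above-transpose-< {fun x} i<j xi<xj)
  }
  where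
  open ExchangePartner
    (exchangePartner {M} {x} {y} agree prefix (≤∧≢⇒< (⊑⇒≤-at-divergence x⊑y prefix) xi≢yi))

data Path (M : ℕ) (y : Perm) : Perm → ℕ → Set where
  arrived : ∀ {x} → x ≐ y → Path M y x 0
  _▸_     : ∀ {x k} (s : Step M x y) → Path M y (Step.next s) k → Path M y x (suc k)

path : ∀ {M x y} → Agree M x y → fun x ⊑ fun y → ∃ (Path M y x)
path {M} {x} {y} = go x (<-wellFounded _)
  where
  distance : Perm → ℕ
  distance v = potential M y (fun y) ∸ potential M y (fun v)
  go : ∀ v → Acc _<_ (distance v) → Agree M v y → fun v ⊑ fun y → ∃ (Path M y v)
  go v (acc rec) agree v⊑y with firstDifference {M} {v} {y} agree
  ... | inj₁ v≐y                 = 0 , arrived v≐y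
  ... | inj₂ (i , i<M , diverges) = Product.map suc (s ▸_)
    (go (Step.next s) (rec (∸-monoʳ-< (Step.progress s) (potential-mono {M} {y} (Step.next⊑y s))))
        (λ n M≤n → trans (Step.agree s n M≤n) (agree n M≤n)) (Step.next⊑y s))
    where
    s : Step M v y
    s = exchangeStep {M} {v} {y} agree v⊑y i<M diverges

Path⇒lengthDiff : ∀ {M x y k} → Path M y x k → LengthDiff x y k
Path⇒lengthDiff {x = x} {y} (arrived x≐y) = lengthDiff-≐ {x} {y} x≐y
Path⇒lengthDiff (s ▸ p)                   = lengthDiff-trans (Step.longer s) (Path⇒lengthDiff p)

-- The interval [σ, ω]^f

module _ (σ ω : Perm) where

  open IntervalPoset σ ω

  private
    Elem : Set
    Elem = Interval σ ω
    perm : Elem → Perm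
    perm = proj₁
    σ≤ : (p : Elem) → σ ≤B perm p
    σ≤ p = proj₁ (proj₂ p)
    ≤ω : (p : Elem) → perm p ≤B ω
    ≤ω p = proj₁ (proj₂ (proj₂ p))
    agreesFrom : Elem → ℕ
    agreesFrom p = proj₁ (proj₂ (proj₂ (proj₂ p)))
    agreesσ : (p : Elem) → Agree (agreesFrom p) (perm p) σ
    agreesσ p = proj₂ (proj₂ (proj₂ (proj₂ p)))

  pathᵢ : (p q : Elem) → perm p ≤B perm q → ∃ (Path (agreesFrom p ⊔ agreesFrom q) (perm q) (perm p))
  pathᵢ p q p≤q =
    path {agreesFrom p ⊔ agreesFrom q} {perm p} {perm q} agree (≤B⇒⊑ {perm p} {perm q} p≤q)
    where
    agree : Agree (agreesFrom p ⊔ agreesFrom q) (perm p) (perm q)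
    agree n le = trans (agreesσ p n (m⊔n≤o⇒m≤o _ _ le)) (sym (agreesσ q n (m⊔n≤o⇒n≤o _ _ le)))

  <ₚ⇒lengthDiff : ∀ {p q} → p <ₚ q → ∃ λ k → LengthDiff (perm p) (perm q) (suc k)
  <ₚ⇒lengthDiff {p} {q} (p≤q , p≢q) with pathᵢ p q p≤q
  ... | 0     , arrived p≐q = contradiction p≐q p≢q
  ... | suc k , steps       = k , Path⇒lengthDiff steps

  nextᵢ : {M : ℕ} (x p : Elem) → Step M (perm x) (perm p) → Elem
  nextᵢ {M} x p s =
      Step.next s
    , ⊑⇒≤B {σ} {Step.next s} (⊑-trans (≤B⇒⊑ {σ} {perm x} (σ≤ x)) (Step.x⊑next s))
    , ⊑⇒≤B {Step.next s} {ω} (⊑-trans (Step.next⊑y s) (≤B⇒⊑ {perm p} {ω} (≤ω p)))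
    , M ⊔ agreesFrom x
    , λ n le → trans (Step.agree s n (m⊔n≤o⇒m≤o _ _ le)) (agreesσ x n (m⊔n≤o⇒n≤o _ _ le))

  ⋖-nextᵢ : {M : ℕ} (x p : Elem) (s : Step M (perm x) (perm p)) → x ⋖ nextᵢ x p s
  ⋖-nextᵢ x p s =
    (⊑⇒≤B {perm x} {Step.next s} (Step.x⊑next s) , lengthDiff-suc⇒≢ (Step.longer s)) , nothing-between
    where
    nothing-between : ∀ z → x <ₚ z → z <ₚ nextᵢ x p s → ⊥
    nothing-between z x<z z<next
      with <ₚ⇒lengthDiff {x} {z} x<z | <ₚ⇒lengthDiff {z} {nextᵢ x p s} z<next
    ... | k , d₁ | _ , d₂ =
      m+1+n≢0 k (suc-injective (lengthDiff-unique (lengthDiff-trans d₁ d₂) (Step.longer s)))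

  Path⇒SatChain : ∀ {M k} (x p : Elem) → Path M (perm p) (perm x) k → SatChain x p k
  Path⇒SatChain x p (arrived x≐p) = done x≐p
  Path⇒SatChain x p (s ▸ steps)   = step (⋖-nextᵢ x p s) (Path⇒SatChain (nextᵢ x p s) p steps)

  ⋖⇒lengthDiff : ∀ {x z} → x ⋖ z → LengthDiff (perm x) (perm z) 1
  ⋖⇒lengthDiff {x} {z} ((x≤z , x≢z) , nothing-between) with pathᵢ x z x≤z
  ... | 0           , arrived x≐z        = contradiction x≐z x≢z
  ... | 1           , s ▸ arrived next≐z = lengthDiff-trans (Step.longer s) (lengthDiff-≐ next≐z)
  ... | suc (suc _) , s ▸ steps          = contradiction
    (⊑⇒≤B {Step.next s} {perm z} (Step.next⊑y s) , lengthDiff-suc⇒≢ (Path⇒lengthDiff steps))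
    (nothing-between (nextᵢ x z s) (proj₁ (⋖-nextᵢ x z s)))

  SatChain⇒lengthDiff : ∀ {x z n} → SatChain x z n → LengthDiff (perm x) (perm z) n
  SatChain⇒lengthDiff (done x≐z)             = lengthDiff-≐ x≐z
  SatChain⇒lengthDiff (step {x} {y} x⋖y y→z) =
    lengthDiff-trans (⋖⇒lengthDiff {x} {y} x⋖y) (SatChain⇒lengthDiff y→z)

  module _ (σ≤ω : σ ≤B ω) where

    0̂ : Elem
    0̂ = σ , (λ _ → Pointwise.refl ≤-refl) , σ≤ω , 0 , λ _ _ → refl

    ρ : Elem → ℕ
    ρ p = proj₁ (pathᵢ 0̂ p (σ≤ p))

    lengthDiff-ρ : ∀ p → LengthDiff σ (perm p) (ρ p)
    lengthDiff-ρ p = Path⇒lengthDiff (proj₂ (pathᵢ 0̂ p (σ≤ p)))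

    0̂-minimal : Minimal 0̂
    0̂-minimal q q<σ with <ₚ⇒lengthDiff {q} {0̂} q<σ
    ... | _ , q→σ = lengthDiff-suc⇒≢ (lengthDiff-trans q→σ (lengthDiff-ρ q)) (λ _ → refl)

    minimal⇒0̂ : ∀ p → Minimal p → perm p ≐ σ
    minimal⇒0̂ p p-minimal with pathᵢ 0̂ p (σ≤ p)
    ... | 0     , arrived σ≐p = λ n → sym (σ≐p n)
    ... | suc _ , steps       =
      ⊥-elim (p-minimal 0̂ (σ≤ p , lengthDiff-suc⇒≢ (Path⇒lengthDiff steps)))

    graded : IsGradedWithRank ρ
    graded = 0̂ , (0̂-minimal , minimal⇒0̂)
           , (λ p → Product.map₂ (Path⇒SatChain 0̂ p) (pathᵢ 0̂ p (σ≤ p)))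
           , λ p n chain → lengthDiff-unique (SatChain⇒lengthDiff chain) (lengthDiff-ρ p)

    ρ-isRelLength : ∀ p → IsRelLength σ (perm p) (ρ p)
    ρ-isRelLength p = eventually-map (λ {i} ℓp≡ℓσ+ρ →
      trans (cong (ℤ._⊖ ℓ i σ) ℓp≡ℓσ+ρ)
            (trans (≤-⊖ (m≤m+n (ℓ i σ) (ρ p))) (cong ℤ.+_ (m+n∸m≡n (ℓ i σ) (ρ p)))))
      (LengthDiff.eventually (lengthDiff-ρ p))

mainTheorem10 : (σ ω : Perm) → σ <B ω →
    Σ (Interval σ ω → ℕ) λ ρ →
      IntervalPoset.IsGradedWithRank σ ω ρ
      × (∀ (x : Interval σ ω) → IsRelLength σ (proj₁ x) (ρ x))
mainTheorem10 σ ω (σ≤ω , _) = ρ σ ω σ≤ω , graded σ ω σ≤ω , ρ-isRelLength σ ω σ≤ω
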